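{- Let $\mathbf{s}$ be a spine in $\{0,\ldots,n-1\}^k$ and $j\in\{0,\ldots,(n-1)k\}$. Let $\mathbf{t}$ be the sequence defined by $t^i=(n-1,\ldots,n-1)-s^{(n-1)k-i}$ for all $i\in\{0,\ldots,(n-1)k\}$. Then $\mathbf{t}$ is a spine and for all $v\in\{0,\ldots,n-1\}^k$, $$h^{\mathbf{t},(n-1)k-j}(v)=(n-1,\ldots,n-1)-h^{\mathbf{s},j}\big((n-1,\ldots,n-1)-v\big).$$
   Context: Order $\{0,\ldots,n-1\}^k$ componentwise; $a<b$ means $a\le b$ and $a\ne b$. A spine is a sequence $\mathbf{s}=(s^0,\ldots,s^{(n-1)k})$ of vertices with $s^0=(0,\ldots,0)$, $s^{(n-1)k}=(n-1,\ldots,n-1)$ and $s^{i+1}>s^i$ for all $i$. For a spine $\mathbf{s}$ define $M(v)=\min\{i: s^i\ge v\}$, $\mu(v)=\max\{i: s^i\le v\}$, and the multi-dimensional herringbone function $h^{\mathbf{s},j}(v)=v$ if $v=s^j$; $s^{i+1}$ if $v=s^i$, $i<j$; $s^{i-1}$ if $v=s^i$, $i>j$; and $v+(s^{\mu(v)+1}-s^{\mu(v)})-(s^{M(v)}-s^{M(v)-1})$ otherwise. -}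

module Defs where

open import Data.Bool using (Bool; true; false; if_then_else_)
open import Data.Nat as ℕ using (ℕ; zero; suc; _∸_; _*_)
open import Data.Integer as ℤ using (ℤ; +_; _-_; _+_)
open import Data.Fin as Fin using (Fin; toℕ; fromℕ; fromℕ<; inject₁; opposite)
open import Data.Fin.Properties using (any?)
open import Data.Vec using (Vec; replicate; zipWith)
open import Data.Vec.Properties using (≡-dec)
open import Data.Vec.Relation.Binary.Pointwise.Inductive as PW using (Pointwise)
open import Data.Vec.Relation.Unary.All using (All)
open import Data.Product using (_×_; _,_)
open import Relation.Nullary using (Dec; yes; no; ¬_)
open import Relation.Nullary.Decidable using (⌊_⌋)
open import Relation.Binary.PropositionalEquality using (_≡_; _≢_)

-- Vertices of {0,…,n-1}^k are represented as integer vectors of length k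
-- (integers so that the difference vectors in the herringbone function are exact),
-- together with the cube-membership predicate InCube.
Vertex : ℕ → Set
Vertex k = Vec ℤ k

InCube : (n : ℕ) {k : ℕ} → Vertex k → Set
InCube n v = All (λ x → (+ 0 ℤ.≤ x) × (x ℤ.< + n)) v

_≤v_ : ∀ {k} → Vertex k → Vertex k → Set
a ≤v b = Pointwise ℤ._≤_ a b

_<v_ : ∀ {k} → Vertex k → Vertex k → Set
a <v b = (a ≤v b) × (a ≢ b)

_≤v?_ : ∀ {k} (a b : Vertex k) → Dec (a ≤v b)
a ≤v? b = PW.decidable ℤ._≤?_ a b

_+v_ _-v_ : ∀ {k} → Vertex k → Vertex k → Vertex k
a +v b = zipWith ℤ._+_ a b
a -v b = zipWith ℤ._-_ a b

zeroV : (k : ℕ) → Vertex k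
zeroV k = replicate k (+ 0)

topV : (n k : ℕ) → Vertex k
topV n k = replicate k (+ (n ∸ 1))

-- (n-1)k, so spines have indices 0,…,(n-1)k, i.e. Fin (suc (len n k))
len : ℕ → ℕ → ℕ
len n k = (n ∸ 1) * k

Seq : ℕ → ℕ → Set
Seq n k = Fin (suc (len n k)) → Vertex k

record IsSpine (n k : ℕ) (s : Seq n k) : Set where
  field
    inCube : ∀ i → InCube n (s i)
    start  : s Fin.zero ≡ zeroV k
    end    : s (fromℕ (len n k)) ≡ topV n k
    incr   : ∀ (i : Fin (len n k)) → s (inject₁ i) <v s (Fin.suc i)

-- first index satisfying P (default: last index)
minFin : ∀ {m} → (Fin (suc m) → Bool) → Fin (suc m)
minFin {zero}  P = Fin.zero
minFin {suc m} P = if P Fin.zero then Fin.zero else Fin.suc (minFin (λ i → P (Fin.suc i)))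

-- last index satisfying P (default: index 0)
maxFin : ∀ {m} → (Fin (suc m) → Bool) → Fin (suc m)
maxFin {zero}  P = Fin.zero
maxFin {suc m} P = if P (fromℕ (suc m)) then fromℕ (suc m) else inject₁ (maxFin (λ i → P (inject₁ i)))

-- ℕ index clamped into Fin (suc m) (clamping never happens in the relevant cases)
clampIdx : ∀ {m} → ℕ → Fin (suc m)
clampIdx {m} i with i ℕ.<? suc m
... | yes p = fromℕ< p
... | no _  = fromℕ m

Mi : ∀ {n k} → Seq n k → Vertex k → Fin (suc (len n k))
Mi s v = minFin (λ i → ⌊ v ≤v? s i ⌋)

μi : ∀ {n k} → Seq n k → Vertex k → Fin (suc (len n k))
μi s v = maxFin (λ i → ⌊ s i ≤v? v ⌋)

at : ∀ {n k} → Seq n k → ℕ → Vertex k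
at s m = s (clampIdx m)

herring : ∀ n {k} → Seq n k → Fin (suc (len n k)) → Vertex k → Vertex k
herring n {k} s j v with any? (λ i → ≡-dec ℤ._≟_ (s i) v)
... | yes (i , _) with toℕ i ℕ.<? toℕ j | toℕ j ℕ.<? toℕ i
...   | yes _ | _     = at {n} s (suc (toℕ i))
...   | no _  | yes _ = at {n} s (toℕ i ∸ 1)
...   | no _  | no _  = v
herring n {k} s j v | no _ =
  (v +v (at {n} s (suc (toℕ (μi {n} s v))) -v s (μi {n} s v)))
     -v (s (Mi {n} s v) -v at {n} s (toℕ (Mi {n} s v) ∸ 1))

reverseSpine : ∀ n {k} → Seq n k → Seq n k
reverseSpine n {k} s i = topV n k -v s (opposite i)

-- Reflection x ↦ top − x reverses the componentwise order, so it maps the spine s to the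
-- spine t read backwards: t^i = top − s^{L−i} with L = (n−1)k.  Hence a vertex is on t
-- iff its reflection is on s (at the opposite index, so "before j" and "after (L−j)" are
-- swapped), and off the spines the roles of M and μ are exchanged:
-- μ_t(v) = L − M_s(top − v) and M_t(v) = L − μ_s(top − v).  In each case of the definition
-- of h the two sides then agree by a linear identity between integer vectors.
module Submission where

open import Defs
open import Data.Bool using (Bool; true; false)
open import Data.Nat as ℕ using (ℕ; zero; suc; _∸_; _⊓_; z≤n; s≤s; _≤′_; ≤′-refl; ≤′-step)
import Data.Nat.Properties as ℕₚ
open import Data.Integer as ℤ using (+_; +≤+; +<+)
import Data.Integer.Properties as ℤₚ
open import Data.Integer.Solver using (module +-*-Solver)
open import Data.Fin as Fin using (Fin; toℕ; fromℕ; fromℕ<; inject₁; opposite)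
import Data.Fin.Properties as Finₚ
open import Data.Vec using ([]; _∷_)
open import Data.Vec.Properties using (≡-dec)
open import Data.Vec.Relation.Binary.Pointwise.Inductive as PW using ([]; _∷_)
open import Data.Vec.Relation.Unary.All using ([]; _∷_)
open import Data.Product using (_×_; _,_; proj₁; proj₂; ∃)
open import Data.Sum using (_⊎_; inj₁; inj₂)
open import Data.Empty using (⊥-elim)
open import Function.Bundles using (_⇔_; mk⇔)
open import Relation.Nullary using (Dec; yes; no; contradiction)
open import Relation.Nullary.Decidable using (⌊_⌋; isYes≗does; does-⇔)
open import Relation.Binary.PropositionalEquality
  using (_≡_; _≢_; refl; sym; trans; cong; cong₂; subst; subst₂; module ≡-Reasoning)
open import Relation.Binary.Definitions using (Tri; tri<; tri≈; tri>)
open import Function using (_∘_)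

-v-involutive : ∀ {k} (c x : Vertex k) → c -v (c -v x) ≡ x
-v-involutive []       []       = refl
-v-involutive (c ∷ cs) (x ∷ xs) = cong₂ _∷_ (solve 2 (λ c x → c :- (c :- x) := x) refl c x)
                                            (-v-involutive cs xs)
  where open +-*-Solver

-v-injectiveʳ : ∀ {k} (c : Vertex k) {a b : Vertex k} → c -v a ≡ c -v b → a ≡ b
-v-injectiveʳ c {a} {b} e = begin
  a               ≡⟨ sym (-v-involutive c a) ⟩
  c -v (c -v a)   ≡⟨ cong (c -v_) e ⟩
  c -v (c -v b)   ≡⟨ -v-involutive c b ⟩
  b               ∎
  where open ≡-Reasoning

-v-self : ∀ {k} (a : Vertex k) → a -v a ≡ zeroV k
-v-self []       = refl
-v-self (a ∷ as) = cong₂ _∷_ (ℤₚ.+-inverseʳ a) (-v-self as)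

-v-zeroV : ∀ {k} (a : Vertex k) → a -v zeroV k ≡ a
-v-zeroV []       = refl
-v-zeroV (a ∷ as) = cong₂ _∷_ (ℤₚ.+-identityʳ a) (-v-zeroV as)

-- The two offset vectors of the herringbone function, seen through the reflection.
-v-reflect-offsets : ∀ {k} (c v a b d e : Vertex k) →
  (v +v ((c -v a) -v (c -v b))) -v ((c -v d) -v (c -v e))
    ≡ c -v (((c -v v) +v (e -v d)) -v (b -v a))
-v-reflect-offsets []       []       []       []       []       []       = refl
-v-reflect-offsets (c ∷ cs) (v ∷ vs) (a ∷ as) (b ∷ bs) (d ∷ ds) (e ∷ es) =
  cong₂ _∷_ (solve 6 (λ c v a b d e →
                       (v :+ ((c :- a) :- (c :- b))) :- ((c :- d) :- (c :- e))
                         := c :- (((c :- v) :+ (e :- d)) :- (b :- a))) refl c v a b d e)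
            (-v-reflect-offsets cs vs as bs ds es)
  where open +-*-Solver

≤v-refl : ∀ {k} (a : Vertex k) → a ≤v a
≤v-refl a = PW.refl ℤₚ.≤-refl

≤v-trans : ∀ {k} {a b c : Vertex k} → a ≤v b → b ≤v c → a ≤v c
≤v-trans = PW.trans ℤₚ.≤-trans

≤v-antisym : ∀ {k} {a b : Vertex k} → a ≤v b → b ≤v a → a ≡ b
≤v-antisym []       []       = refl
≤v-antisym (p ∷ ps) (q ∷ qs) = cong₂ _∷_ (ℤₚ.≤-antisym p q) (≤v-antisym ps qs)

-v-antitoneʳ : ∀ {k} (c : Vertex k) {a b : Vertex k} → a ≤v b → (c -v b) ≤v (c -v a)
-v-antitoneʳ []       []       = []
-v-antitoneʳ (c ∷ cs) (p ∷ ps) = ℤₚ.+-monoʳ-≤ c (ℤₚ.neg-mono-≤ p) ∷ -v-antitoneʳ cs ps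

-v-<v-antitoneʳ : ∀ {k} (c : Vertex k) {a b : Vertex k} → a <v b → (c -v b) <v (c -v a)
-v-<v-antitoneʳ c (a≤b , a≢b) = -v-antitoneʳ c a≤b , λ e → a≢b (sym (-v-injectiveʳ c e))

-v-≤v-flip : ∀ {k} (c a b : Vertex k) → (c -v a) ≤v b ⇔ (c -v b) ≤v a
-v-≤v-flip c a b = mk⇔ (flip a b) (flip b a)
  where
  flip : ∀ x y → (c -v x) ≤v y → (c -v y) ≤v x
  flip x y p = subst ((c -v y) ≤v_) (-v-involutive c x) (-v-antitoneʳ c p)

≤v--v-flip : ∀ {k} (c a b : Vertex k) → a ≤v (c -v b) ⇔ b ≤v (c -v a)
≤v--v-flip c a b = mk⇔ (flip a b) (flip b a)
  where
  flip : ∀ x y → x ≤v (c -v y) → y ≤v (c -v x)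
  flip x y p = subst (_≤v (c -v x)) (-v-involutive c y) (-v-antitoneʳ c p)

topV-reflect-inCube : ∀ n {k} (x : Vertex k) → InCube n x → InCube n (topV n k -v x)
topV-reflect-inCube n []       []       = []
topV-reflect-inCube n (x ∷ xs) (p ∷ ps) = reflect n x p ∷ topV-reflect-inCube n xs ps
  where
  reflect : ∀ n x → (+ 0 ℤ.≤ x) × (x ℤ.< + n) →
            (+ 0 ℤ.≤ + (n ∸ 1) ℤ.- x) × (+ (n ∸ 1) ℤ.- x ℤ.< + n)
  reflect (suc n) (+ m) (_ , +<+ m<1+n)
    rewrite ℤₚ.m-n≡m⊖n n m | ℤₚ.⊖-≥ (ℕₚ.≤-pred m<1+n) =
    +≤+ z≤n , +<+ (s≤s (ℕₚ.m∸n≤m n m))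

isYes-⇔ : ∀ {A B : Set} → A ⇔ B → (a? : Dec A) (b? : Dec B) → ⌊ a? ⌋ ≡ ⌊ b? ⌋
isYes-⇔ A⇔B a? b? =
  trans (isYes≗does a?) (trans (does-⇔ A⇔B a? b?) (sym (isYes≗does b?)))

toℕ-opposite : ∀ {m} (x : Fin (suc m)) → toℕ (opposite x) ≡ m ∸ toℕ x
toℕ-opposite = Finₚ.opposite-prop

opposite-fromℕ : ∀ m → opposite (fromℕ m) ≡ Fin.zero
opposite-fromℕ zero    = refl
opposite-fromℕ (suc m) = cong inject₁ (opposite-fromℕ m)

opposite-inject₁ : ∀ {m} (i : Fin m) → opposite (inject₁ i) ≡ Fin.suc (opposite i)
opposite-inject₁ Fin.zero    = refl
opposite-inject₁ (Fin.suc i) = cong inject₁ (opposite-inject₁ i)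

minFin-cong : ∀ {m} {P Q : Fin (suc m) → Bool} → (∀ i → P i ≡ Q i) → minFin P ≡ minFin Q
minFin-cong {zero}  P≗Q = refl
minFin-cong {suc m} P≗Q rewrite P≗Q Fin.zero | minFin-cong (λ i → P≗Q (Fin.suc i)) = refl

maxFin-cong : ∀ {m} {P Q : Fin (suc m) → Bool} → (∀ i → P i ≡ Q i) → maxFin P ≡ maxFin Q
maxFin-cong {zero}  P≗Q = refl
maxFin-cong {suc m} P≗Q rewrite P≗Q (fromℕ (suc m)) | maxFin-cong (λ i → P≗Q (inject₁ i)) = refl

minFin-opposite : ∀ {m} (P : Fin (suc m) → Bool) →
                  minFin (λ i → P (opposite i)) ≡ opposite (maxFin P)
minFin-opposite {zero}  P = refl
minFin-opposite {suc m} P with P (fromℕ (suc m))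
... | true  = sym (opposite-fromℕ (suc m))
... | false = trans (cong Fin.suc (minFin-opposite (λ i → P (inject₁ i))))
                    (sym (opposite-inject₁ (maxFin (λ i → P (inject₁ i)))))

maxFin-opposite : ∀ {m} (P : Fin (suc m) → Bool) →
                  maxFin (λ i → P (opposite i)) ≡ opposite (minFin P)
maxFin-opposite P = begin
  maxFin P′                                   ≡⟨ sym (Finₚ.opposite-involutive _) ⟩
  opposite (opposite (maxFin P′))             ≡⟨ cong opposite (minFin-opposite P′) ⟨
  opposite (minFin (λ i → P′ (opposite i)))   ≡⟨ cong opposite (minFin-cong P′∘opposite≗P) ⟩
  opposite (minFin P)                         ∎
  where
  open ≡-Reasoning
  P′ = λ i → P (opposite i)
  P′∘opposite≗P : ∀ i → P′ (opposite i) ≡ P i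
  P′∘opposite≗P i = cong P (Finₚ.opposite-involutive i)

toℕ-clampIdx : ∀ {m} i → toℕ (clampIdx {m} i) ≡ i ⊓ m
toℕ-clampIdx {m} i with i ℕ.<? suc m
... | yes i<1+m = trans (Finₚ.toℕ-fromℕ< i<1+m) (sym (ℕₚ.m≤n⇒m⊓n≡m (ℕₚ.≤-pred i<1+m)))
... | no  i≮1+m = trans (Finₚ.toℕ-fromℕ m) (sym (ℕₚ.m≥n⇒m⊓n≡n (ℕₚ.<⇒≤ (ℕₚ.≮⇒≥ i≮1+m))))

clampIdx-cong : ∀ {m} {i j} → i ⊓ m ≡ j ⊓ m → clampIdx {m} i ≡ clampIdx j
clampIdx-cong {m} {i} {j} e =
  Finₚ.toℕ-injective (trans (toℕ-clampIdx i) (trans e (sym (toℕ-clampIdx j))))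

clampIdx-toℕ : ∀ {m} (x : Fin (suc m)) → clampIdx (toℕ x) ≡ x
clampIdx-toℕ x = Finₚ.toℕ-injective
  (trans (toℕ-clampIdx (toℕ x)) (ℕₚ.m≤n⇒m⊓n≡m (Finₚ.toℕ≤pred[n] x)))

opposite-clampIdx : ∀ {m} i → opposite (clampIdx {m} i) ≡ clampIdx (m ∸ i)
opposite-clampIdx {m} i = Finₚ.toℕ-injective (begin
  toℕ (opposite (clampIdx i))   ≡⟨ toℕ-opposite (clampIdx i) ⟩
  m ∸ toℕ (clampIdx i)          ≡⟨ cong (m ∸_) (toℕ-clampIdx i) ⟩
  m ∸ (i ⊓ m)                   ≡⟨ ℕₚ.∸-distribˡ-⊓-⊔ m i m ⟩
  (m ∸ i) ℕ.⊔ (m ∸ m)           ≡⟨ cong ((m ∸ i) ℕ.⊔_) (ℕₚ.n∸n≡0 m) ⟩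
  (m ∸ i) ℕ.⊔ 0                 ≡⟨ ℕₚ.⊔-identityʳ (m ∸ i) ⟩
  m ∸ i                         ≡⟨ ℕₚ.m≤n⇒m⊓n≡m (ℕₚ.m∸n≤m m i) ⟨
  (m ∸ i) ⊓ m                   ≡⟨ toℕ-clampIdx (m ∸ i) ⟨
  toℕ (clampIdx (m ∸ i))        ∎)
  where open ≡-Reasoning

opposite-<-antitone : ∀ {m} {i j : Fin (suc m)} → toℕ i ℕ.< toℕ j →
                      toℕ (opposite j) ℕ.< toℕ (opposite i)
opposite-<-antitone {m} {i} {j} i<j =
  subst₂ ℕ._<_ (sym (toℕ-opposite j)) (sym (toℕ-opposite i))
         (ℕₚ.∸-monoʳ-< i<j (Finₚ.toℕ≤pred[n] j))

module Increasing {n k} (s : Seq n k)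
                  (incr : ∀ (i : Fin (len n k)) → s (inject₁ i) <v s (Fin.suc i)) where

  private
    L = len n k

  at-toℕ : ∀ (x : Fin (suc L)) → at {n} s (toℕ x) ≡ s x
  at-toℕ x = cong s (clampIdx-toℕ x)

  at-<v-suc : ∀ {m} → m ℕ.< L → at {n} s m <v at {n} s (suc m)
  at-<v-suc {m} m<L = subst₂ _<v_ (index (trans (Finₚ.toℕ-inject₁ i) (Finₚ.toℕ-fromℕ< m<L)))
                                  (index (cong suc (Finₚ.toℕ-fromℕ< m<L)))
                                  (incr i)
    where
    i = fromℕ< m<L
    index : ∀ {x : Fin (suc L)} {p} → toℕ x ≡ p → s x ≡ at {n} s p
    index {x} refl = sym (at-toℕ x)

  at-monotone : ∀ {m p} → m ≤′ p → p ℕ.≤ L → at {n} s m ≤v at {n} s p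
  at-monotone ≤′-refl      _   = ≤v-refl _
  at-monotone (≤′-step m≤p) p<L = ≤v-trans (at-monotone m≤p (ℕₚ.<⇒≤ p<L)) (proj₁ (at-<v-suc p<L))

  at-strict : ∀ {m p} → m ℕ.< p → p ℕ.≤ L → at {n} s m ≢ at {n} s p
  at-strict {m} {suc p} (s≤s m≤p) p<L e = proj₂ (at-<v-suc p<L)
    (≤v-antisym (proj₁ (at-<v-suc p<L))
                (subst (_≤v at {n} s p) e (at-monotone (ℕₚ.≤⇒≤′ m≤p) (ℕₚ.<⇒≤ p<L))))

  injective : ∀ {a b : Fin (suc L)} → s a ≡ s b → a ≡ b
  injective {a} {b} e with ℕₚ.<-cmp (toℕ a) (toℕ b)
  ... | tri< a<b _ _ = contradiction (trans (at-toℕ a) (trans e (sym (at-toℕ b))))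
                                     (at-strict a<b (Finₚ.toℕ≤pred[n] b))
  ... | tri≈ _ a≡b _ = Finₚ.toℕ-injective a≡b
  ... | tri> _ _ b<a = contradiction (trans (at-toℕ b) (trans (sym e) (sym (at-toℕ a))))
                                     (at-strict b<a (Finₚ.toℕ≤pred[n] a))

module Herring {n k} (s : Seq n k) (injective : ∀ {a b} → s a ≡ s b → a ≡ b) where

  herring-before : ∀ {i j v} → s i ≡ v → toℕ i ℕ.< toℕ j → herring n s j v ≡ at {n} s (suc (toℕ i))
  herring-before {i} {j} {v} e i<j with Finₚ.any? (λ x → ≡-dec ℤ._≟_ (s x) v)
  ... | no v∉s = ⊥-elim (v∉s (i , e))
  ... | yes (i′ , e′) with injective (trans e′ (sym e))
  ...   | refl with toℕ i ℕ.<? toℕ j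
  ...     | yes _   = refl
  ...     | no  i≮j = contradiction i<j i≮j

  herring-after : ∀ {i j v} → s i ≡ v → toℕ j ℕ.< toℕ i → herring n s j v ≡ at {n} s (toℕ i ∸ 1)
  herring-after {i} {j} {v} e j<i with Finₚ.any? (λ x → ≡-dec ℤ._≟_ (s x) v)
  ... | no v∉s = ⊥-elim (v∉s (i , e))
  ... | yes (i′ , e′) with injective (trans e′ (sym e))
  ...   | refl with toℕ i ℕ.<? toℕ j | toℕ j ℕ.<? toℕ i
  ...     | yes i<j | _       = contradiction i<j (ℕₚ.<-asym j<i)
  ...     | no _    | yes _   = refl
  ...     | no _    | no  j≮i = contradiction j<i j≮i

  herring-fixed : ∀ {i j v} → s i ≡ v → toℕ i ≡ toℕ j → herring n s j v ≡ v
  herring-fixed {i} {j} {v} e i≡j with Finₚ.any? (λ x → ≡-dec ℤ._≟_ (s x) v)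
  ... | no v∉s = ⊥-elim (v∉s (i , e))
  ... | yes (i′ , e′) with injective (trans e′ (sym e))
  ...   | refl with toℕ i ℕ.<? toℕ j | toℕ j ℕ.<? toℕ i
  ...     | yes i<j | _       = contradiction i≡j (ℕₚ.<⇒≢ i<j)
  ...     | no _    | yes j<i = contradiction (sym i≡j) (ℕₚ.<⇒≢ j<i)
  ...     | no _    | no _    = refl

  herring-offSpine : ∀ {j v} → (∀ i → s i ≢ v) →
    herring n s j v ≡ (v +v (at {n} s (suc (toℕ (μi {n} s v))) -v s (μi {n} s v)))
                       -v (s (Mi {n} s v) -v at {n} s (toℕ (Mi {n} s v) ∸ 1))
  herring-offSpine {j} {v} v∉s with Finₚ.any? (λ x → ≡-dec ℤ._≟_ (s x) v)
  ... | yes (i , e) = contradiction e (v∉s i)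
  ... | no _        = refl

module Reversal {n k} (s : Seq n k) where

  private
    L   = len n k
    top = topV n k
    t   = reverseSpine n s

  reverseSpine-opposite : ∀ x → t (opposite x) ≡ top -v s x
  reverseSpine-opposite x = cong (λ y → top -v s y) (Finₚ.opposite-involutive x)

  reverseSpine-opposite-reflect : ∀ {i v} → s i ≡ top -v v → t (opposite i) ≡ v
  reverseSpine-opposite-reflect {i} {v} e =
    trans (reverseSpine-opposite i) (trans (cong (top -v_) e) (-v-involutive top v))

  reverseSpine-isSpine : IsSpine n k s → IsSpine n k t
  reverseSpine-isSpine sp = record
    { inCube = λ i → topV-reflect-inCube n (s (opposite i)) (inCube (opposite i))
    ; start  = trans (cong (top -v_) end) (-v-self top)
    ; end    = trans (cong (λ x → top -v s x) (opposite-fromℕ L))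
                     (trans (cong (top -v_) start) (-v-zeroV top))
    ; incr   = λ i → subst (λ x → (top -v s x) <v t (Fin.suc i)) (sym (opposite-inject₁ i))
                           (-v-<v-antitoneʳ top (incr (opposite i)))
    }
    where open IsSpine sp

  at-reverseSpine : ∀ m → at {n} t m ≡ top -v at {n} s (L ∸ m)
  at-reverseSpine m = cong (λ x → top -v s x) (opposite-clampIdx m)

  at-reverseSpine-suc : ∀ x → at {n} t (suc (toℕ (opposite x))) ≡ top -v at {n} s (toℕ x ∸ 1)
  at-reverseSpine-suc x =
    trans (at-reverseSpine (suc (toℕ (opposite x)))) (cong (λ p → top -v at {n} s p) index)
    where
    open ≡-Reasoning
    index : L ∸ suc (toℕ (opposite x)) ≡ toℕ x ∸ 1
    index = begin
      L ∸ suc (toℕ (opposite x))   ≡⟨ cong (λ p → L ∸ suc p) (toℕ-opposite x) ⟩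
      L ∸ suc (L ∸ toℕ x)          ≡⟨ ℕₚ.pred[m∸n]≡m∸[1+n] L (L ∸ toℕ x) ⟨
      ℕ.pred (L ∸ (L ∸ toℕ x))     ≡⟨ cong ℕ.pred (ℕₚ.m∸[m∸n]≡n (Finₚ.toℕ≤pred[n] x)) ⟩
      ℕ.pred (toℕ x)               ≡⟨ ℕₚ.pred[m∸n]≡m∸[1+n] (toℕ x) 0 ⟩
      toℕ x ∸ 1                    ∎

  -- At x = L the index on the left is L while the one on the right is L + 1; clamping
  -- identifies them.
  at-reverseSpine-pred : ∀ x → at {n} t (toℕ (opposite x) ∸ 1) ≡ top -v at {n} s (suc (toℕ x))
  at-reverseSpine-pred x = trans (at-reverseSpine (toℕ (opposite x) ∸ 1))
    (cong (λ i → top -v s i) (clampIdx-cong (index (ℕₚ.m≤n⇒m<n∨m≡n (Finₚ.toℕ≤pred[n] x)))))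
    where
    index : toℕ x ℕ.< L ⊎ toℕ x ≡ L → (L ∸ (toℕ (opposite x) ∸ 1)) ⊓ L ≡ suc (toℕ x) ⊓ L
    index (inj₁ x<L) = cong (_⊓ L) (begin
      L ∸ (toℕ (opposite x) ∸ 1)   ≡⟨ cong (λ p → L ∸ (p ∸ 1)) (toℕ-opposite x) ⟩
      L ∸ (L ∸ toℕ x ∸ 1)          ≡⟨ cong (L ∸_) (ℕₚ.pred[m∸n]≡m∸[1+n] (L ∸ toℕ x) 0) ⟨
      L ∸ ℕ.pred (L ∸ toℕ x)       ≡⟨ cong (L ∸_) (ℕₚ.pred[m∸n]≡m∸[1+n] L (toℕ x)) ⟩
      L ∸ (L ∸ suc (toℕ x))        ≡⟨ ℕₚ.m∸[m∸n]≡n x<L ⟩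
      suc (toℕ x)                  ∎)
      where open ≡-Reasoning
    index (inj₂ x≡L) = begin
      (L ∸ (toℕ (opposite x) ∸ 1)) ⊓ L  ≡⟨ cong (λ p → (L ∸ (p ∸ 1)) ⊓ L) (toℕ-opposite x) ⟩
      (L ∸ (L ∸ toℕ x ∸ 1)) ⊓ L         ≡⟨ cong (λ p → (L ∸ (L ∸ p ∸ 1)) ⊓ L) x≡L ⟩
      (L ∸ (L ∸ L ∸ 1)) ⊓ L             ≡⟨ cong (λ p → (L ∸ (p ∸ 1)) ⊓ L) (ℕₚ.n∸n≡0 L) ⟩
      L ⊓ L                             ≡⟨ ℕₚ.⊓-idem L ⟩
      L                                 ≡⟨ ℕₚ.m≥n⇒m⊓n≡n (ℕₚ.n≤1+n L) ⟨
      suc L ⊓ L                         ≡⟨ cong (λ p → suc p ⊓ L) x≡L ⟨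
      suc (toℕ x) ⊓ L                   ∎
      where open ≡-Reasoning

  μi-reverseSpine : ∀ v → μi {n} t v ≡ opposite (Mi {n} s (top -v v))
  μi-reverseSpine v =
    trans (maxFin-cong (λ i → isYes-⇔ (-v-≤v-flip top (s (opposite i)) v) _ _))
          (maxFin-opposite (λ i → ⌊ (top -v v) ≤v? s i ⌋))

  Mi-reverseSpine : ∀ v → Mi {n} t v ≡ opposite (μi {n} s (top -v v))
  Mi-reverseSpine v =
    trans (minFin-cong (λ i → isYes-⇔ (≤v--v-flip top v (s (opposite i))) _ _))
          (minFin-opposite (λ i → ⌊ s i ≤v? (top -v v) ⌋))

  module _ (sp : IsSpine n k s) where

    private
      module S = Herring {n} s (Increasing.injective {n} s (IsSpine.incr sp))
      module T = Herring {n} t (Increasing.injective {n} t (IsSpine.incr (reverseSpine-isSpine sp)))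

    herring-reverse-onSpine : ∀ j v i → s i ≡ top -v v →
      herring n t (opposite j) v ≡ top -v herring n s j (top -v v)
    herring-reverse-onSpine j v i e = byOrder (ℕₚ.<-cmp (toℕ i) (toℕ j))
      where
      open ≡-Reasoning
      v-on-t : t (opposite i) ≡ v
      v-on-t = reverseSpine-opposite-reflect e
      byOrder : Tri (toℕ i ℕ.< toℕ j) (toℕ i ≡ toℕ j) (toℕ j ℕ.< toℕ i) →
                herring n t (opposite j) v ≡ top -v herring n s j (top -v v)
      byOrder (tri< i<j _ _) = begin
        herring n t (opposite j) v          ≡⟨ T.herring-after v-on-t (opposite-<-antitone i<j) ⟩
        at {n} t (toℕ (opposite i) ∸ 1)     ≡⟨ at-reverseSpine-pred i ⟩
        top -v at {n} s (suc (toℕ i))       ≡⟨ cong (top -v_) (S.herring-before e i<j) ⟨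
        top -v herring n s j (top -v v)     ∎
      byOrder (tri≈ _ i≡j _) = begin
        herring n t (opposite j) v          ≡⟨ T.herring-fixed v-on-t (cong (toℕ ∘ opposite) (Finₚ.toℕ-injective i≡j)) ⟩
        v                                   ≡⟨ -v-involutive top v ⟨
        top -v (top -v v)                   ≡⟨ cong (top -v_) (S.herring-fixed e i≡j) ⟨
        top -v herring n s j (top -v v)     ∎
      byOrder (tri> _ _ j<i) = begin
        herring n t (opposite j) v          ≡⟨ T.herring-before v-on-t (opposite-<-antitone j<i) ⟩
        at {n} t (suc (toℕ (opposite i)))   ≡⟨ at-reverseSpine-suc i ⟩
        top -v at {n} s (toℕ i ∸ 1)         ≡⟨ cong (top -v_) (S.herring-after e j<i) ⟨
        top -v herring n s j (top -v v)     ∎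

    herring-reverse-offSpine : ∀ j v → (∀ i → s i ≢ top -v v) →
      herring n t (opposite j) v ≡ top -v herring n s j (top -v v)
    herring-reverse-offSpine j v u∉s = begin
      herring n t (opposite j) v
        ≡⟨ T.herring-offSpine v∉t ⟩
      (v +v (at {n} t (suc (toℕ (μi {n} t v))) -v t (μi {n} t v)))
        -v (t (Mi {n} t v) -v at {n} t (toℕ (Mi {n} t v) ∸ 1))
        ≡⟨ cong₂ offsets (μi-reverseSpine v) (Mi-reverseSpine v) ⟩
      offsets (opposite M) (opposite μ)
        ≡⟨ cong₂ _-v_ (cong₂ (λ a b → v +v (a -v b)) (at-reverseSpine-suc M) (reverseSpine-opposite M))
                      (cong₂ _-v_ (reverseSpine-opposite μ) (at-reverseSpine-pred μ)) ⟩
      (v +v ((top -v at {n} s (toℕ M ∸ 1)) -v (top -v s M)))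
        -v ((top -v s μ) -v (top -v at {n} s (suc (toℕ μ))))
        ≡⟨ -v-reflect-offsets top v _ _ _ _ ⟩
      top -v (((top -v v) +v (at {n} s (suc (toℕ μ)) -v s μ)) -v (s M -v at {n} s (toℕ M ∸ 1)))
        ≡⟨ cong (top -v_) (S.herring-offSpine u∉s) ⟨
      top -v herring n s j (top -v v)
        ∎
      where
      open ≡-Reasoning
      M μ : Fin (suc L)
      M = Mi {n} s (top -v v)
      μ = μi {n} s (top -v v)
      offsets : Fin (suc L) → Fin (suc L) → Vertex k
      offsets μ′ M′ = (v +v (at {n} t (suc (toℕ μ′)) -v t μ′)) -v (t M′ -v at {n} t (toℕ M′ ∸ 1))
      v∉t : ∀ i → t i ≢ v
      v∉t i e = u∉s (opposite i) (begin
        s (opposite i)                   ≡⟨ -v-involutive top _ ⟨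
        top -v (top -v s (opposite i))   ≡⟨ cong (top -v_) e ⟩
        top -v v                         ∎)

    herring-reverseSpine : ∀ j v → herring n t (opposite j) v ≡ top -v herring n s j (top -v v)
    herring-reverseSpine j v = byCases (Finₚ.any? (λ i → ≡-dec ℤ._≟_ (s i) (top -v v)))
      where
      byCases : Dec (∃ λ i → s i ≡ top -v v) →
                herring n t (opposite j) v ≡ top -v herring n s j (top -v v)
      byCases (yes (i , e)) = herring-reverse-onSpine j v i e
      byCases (no  u∉s)     = herring-reverse-offSpine j v (λ i e → u∉s (i , e))

open Reversal

lemma14 : (n k : ℕ) (s : Seq n k) (j : Fin (suc (len n k))) →
    IsSpine n k s →
    IsSpine n k (reverseSpine n s) ×
      ((v : Vertex k) → InCube n v →
        herring n (reverseSpine n s) (opposite j) v ≡ topV n k -v herring n s j (topV n k -v v))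
-- The identity holds for every integer vector v, in the cube or not.
lemma14 n k s j sp = reverseSpine-isSpine s sp , λ v _ → herring-reverseSpine s sp j v
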